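{- For all positive integers $k_1,k_2$, $$WER_3(k_1,k_2)\le R_4(k_1,\,k_1+2,\,k_1+2,\,k_1,\,k_1+2,\,k_1,\,k_2^5).$$
   Context: For a coloring $COL:\binom{[n]}{3}\to\omega$ of the 3-element subsets of $[n]$ and $I\subsetneq\{1,2,3\}$, a set $V\subseteq[n]$ is $I$-weakly homogeneous ($I$-whomog) if for all $x_1<x_2<x_3$ and $y_1<y_2<y_3$ in $V$ with $x_i=y_i$ for all $i\in I$ we have $COL(x_1,x_2,x_3)=COL(y_1,y_2,y_3)$. $V$ is whomog if it is $I$-whomog for some proper subset $I$ of $\{1,2,3\}$. $V$ is rainbow if all elements of $\binom{V}{3}$ receive pairwise different colors. $WER_3(k_1,k_2)$ is the least $n$ such that every $COL:\binom{[n]}{3}\to\omega$ has a whomog set of size $k_1$ or a rainbow set of size $k_2$. For positive integers $k_1,\dots,k_c$, $R_4(k_1,\dots,k_c)$ is the least $n$ such that for every coloring $\binom{[n]}{4}\to[c]$ there is some $i\in[c]$ and a set of size $k_i$ all of whose 4-element subsets have color $i$. -}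

module Defs where

open import Data.Nat using (ℕ; _≤_; _<_)
open import Data.Fin using (Fin; toℕ; zero; suc)
open import Data.Fin.Subset using (Subset; _∈_; _∉_; ∣_∣)
open import Data.Vec using (Vec; lookup)
open import Data.Sum using (_⊎_)
open import Data.Product using (_×_; Σ; ∃; ∃-syntax)
open import Relation.Binary.PropositionalEquality using (_≡_)

-- The ground set [n] is represented by Fin n, ordered via toℕ.
_<ꟳ_ : {n : ℕ} → Fin n → Fin n → Set
a <ꟳ b = toℕ a < toℕ b

-- A colouring of the 3-subsets of [n] with colours in ω.
-- A 3-subset {x1<x2<x3} gets colour COL x1 x2 x3; values at
-- non-increasing arguments are irrelevant.
Col3 : ℕ → Set
Col3 n = Fin n → Fin n → Fin n → ℕ

coord : {A : Set} → Fin 3 → A → A → A → A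
coord zero          a b c = a
coord (suc zero)    a b c = b
coord (suc (suc zero)) a b c = c

Proper : Subset 3 → Set
Proper I = ∃[ i ] (i ∉ I)

IWhomog : {n : ℕ} → Col3 n → Subset 3 → Subset n → Set
IWhomog {n} COL I V =
  ∀ (x₁ x₂ x₃ y₁ y₂ y₃ : Fin n) →
  x₁ ∈ V → x₂ ∈ V → x₃ ∈ V → x₁ <ꟳ x₂ → x₂ <ꟳ x₃ →
  y₁ ∈ V → y₂ ∈ V → y₃ ∈ V → y₁ <ꟳ y₂ → y₂ <ꟳ y₃ →
  (∀ i → i ∈ I → coord i x₁ x₂ x₃ ≡ coord i y₁ y₂ y₃) →
  COL x₁ x₂ x₃ ≡ COL y₁ y₂ y₃

Whomog : {n : ℕ} → Col3 n → Subset n → Set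
Whomog COL V = ∃[ I ] (Proper I × IWhomog COL I V)

Rainbow : {n : ℕ} → Col3 n → Subset n → Set
Rainbow {n} COL V =
  ∀ (x₁ x₂ x₃ y₁ y₂ y₃ : Fin n) →
  x₁ ∈ V → x₂ ∈ V → x₃ ∈ V → x₁ <ꟳ x₂ → x₂ <ꟳ x₃ →
  y₁ ∈ V → y₂ ∈ V → y₃ ∈ V → y₁ <ꟳ y₂ → y₂ <ꟳ y₃ →
  COL x₁ x₂ x₃ ≡ COL y₁ y₂ y₃ →
  (x₁ ≡ y₁ × x₂ ≡ y₂ × x₃ ≡ y₃)

WERProp : ℕ → ℕ → ℕ → Set
WERProp k₁ k₂ n =
  ∀ (COL : Col3 n) →
  Σ (Subset n) (λ V → ∣ V ∣ ≡ k₁ × Whomog COL V)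
  ⊎ Σ (Subset n) (λ V → ∣ V ∣ ≡ k₂ × Rainbow COL V)

Col4 : ℕ → ℕ → Set
Col4 n c = Fin n → Fin n → Fin n → Fin n → Fin c

R4Prop : (c : ℕ) → Vec ℕ c → ℕ → Set
R4Prop c ks n =
  ∀ (COL : Col4 n c) → ∃[ i ] Σ (Subset n) (λ V → ∣ V ∣ ≡ lookup ks i ×
    (∀ (x₁ x₂ x₃ x₄ : Fin n) →
      x₁ ∈ V → x₂ ∈ V → x₃ ∈ V → x₄ ∈ V →
      x₁ <ꟳ x₂ → x₂ <ꟳ x₃ → x₃ <ꟳ x₄ →
      COL x₁ x₂ x₃ x₄ ≡ i))

IsLeast : (ℕ → Set) → ℕ → Set
IsLeast P m = P m × (∀ k → P k → m ≤ k)

module Submission where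

open import Defs
open import Data.Nat using (ℕ; _≤_; _+_; _^_)
open import Data.Vec using (_∷_; [])
open import Data.Product using (_,_)
open import Data.Sum using (inj₁; inj₂)
open import Data.Fin using (zero; suc)
open import Relation.Binary.Definitions using (DecidableEquality)
open import Relation.Binary.PropositionalEquality using (_≡_)

-- Given COL on the 3-sets of [r], colour every 4-set w < x < y < z by which equalities hold among
-- A = COL w x y, B = COL w x z, C = COL w y z, D = COL x y z (seven classes, see classify).
-- The Ramsey property gives a set V homogeneous for one class:
--   A = B, B = C or C = D (|V| = k₁): V is whomog for I = {1,2}, {1,3} or {2,3};
--   A = C ≠ B, B = D ≠ C or A = D ≠ B (|V| = k₁ + 2): five increasing points would contradict
--     the class, so k₁ ≤ 2 and any k₁ points are whomog for I = ∅, containing no 3-set;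
--   all four distinct (|V| = k₂⁵): two 3-sets of V sharing two points have different colours,
--     and a greedy extraction finds k₂ points spanning a rainbow.

module Counting where
  open import Data.Nat using (ℕ; suc; _+_; _*_; _≤_; _<_; z≤n; s≤s; _≤?_)
  open import Data.Nat.Properties
  open import Data.Nat.ListAction using (sum)
  open import Data.List using (List; []; _∷_; length; map; filter)
  open import Data.List.Properties using (map-cong)
  open import Data.List.Relation.Unary.Any using (Any; here; there; any?)
  open import Data.List.Relation.Unary.All using (All; []; _∷_)
  open import Data.List.Membership.Propositional using (_∈_)
  open import Data.List.Relation.Unary.Unique.Propositional using (Unique)
  open import Data.List.Relation.Unary.AllPairs using ([]; _∷_)
  open import Data.Sum using (_⊎_; inj₁; inj₂)
  open import Data.Product using (Σ; _×_; _,_)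
  open import Data.Empty using (⊥-elim)
  open import Relation.Nullary using (¬_; Dec; yes; no; ¬?)
  open import Relation.Nullary.Decidable using (_⊎-dec_)
  open import Relation.Unary using (Decidable)
  open import Relation.Binary.PropositionalEquality using (_≡_; refl; sym; trans; cong; cong₂; subst; subst₂; module ≡-Reasoning)
  open import Algebra.Properties.CommutativeSemigroup +-commutativeSemigroup using (interchange)

  count : {A : Set} {P : A → Set} → Decidable P → List A → ℕ
  count P? xs = length (filter P? xs)

  module _ {A : Set} where

    length≤count+count¬ : {P : A → Set} (P? : Decidable P) (xs : List A) →
      length xs ≤ count P? xs + count (λ x → ¬? (P? x)) xs
    length≤count+count¬ P? [] = z≤n
    length≤count+count¬ P? (x ∷ xs) with P? x
    ... | yes _ = s≤s (length≤count+count¬ P? xs)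
    ... | no _ rewrite +-suc (count P? xs) (count (λ x → ¬? (P? x)) xs) = s≤s (length≤count+count¬ P? xs)

    count≤1 : {P : A → Set} (P? : Decidable P) {xs : List A} → Unique xs →
      (∀ {x y} → x ∈ xs → y ∈ xs → P x → P y → x ≡ y) → count P? xs ≤ 1
    count≤1 P? {[]} [] atMostOne = z≤n
    count≤1 {P} P? {x ∷ xs} (x∉xs ∷ u) atMostOne with P? x
    ... | no _ = count≤1 P? u (λ mx my → atMostOne (there mx) (there my))
    ... | yes px = s≤s (≤-reflexive (noOther xs x∉xs (λ m → atMostOne (here refl) (there m) px)))
      where
        noOther : ∀ ys → All (λ y → ¬ x ≡ y) ys → (∀ {y} → y ∈ ys → P y → x ≡ y) → count P? ys ≡ 0
        noOther [] [] _ = refl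
        noOther (y ∷ ys) (x≢y ∷ rest) eq with P? y
        ... | yes py = ⊥-elim (x≢y (eq (here refl) py))
        ... | no _ = noOther ys rest (λ m → eq (there m))

    count-mono : {P Q : A → Set} (P? : Decidable P) (Q? : Decidable Q) (xs : List A) →
      (∀ {x} → x ∈ xs → P x → Q x) → count P? xs ≤ count Q? xs
    count-mono P? Q? [] _ = z≤n
    count-mono P? Q? (x ∷ xs) P⇒Q with P? x | Q? x
    ... | yes px | yes _  = s≤s (count-mono P? Q? xs (λ m → P⇒Q (there m)))
    ... | yes px | no ¬qx = ⊥-elim (¬qx (P⇒Q (here refl) px))
    ... | no _   | yes _  = m≤n⇒m≤1+n (count-mono P? Q? xs (λ m → P⇒Q (there m)))
    ... | no _   | no _   = count-mono P? Q? xs (λ m → P⇒Q (there m))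

    count-⊎ : {P Q : A → Set} (P? : Decidable P) (Q? : Decidable Q) (xs : List A) →
      count (λ x → P? x ⊎-dec Q? x) xs ≤ count P? xs + count Q? xs
    count-⊎ P? Q? [] = z≤n
    count-⊎ P? Q? (x ∷ xs) with P? x | Q? x
    ... | yes _ | yes _ = s≤s (≤-trans (count-⊎ P? Q? xs) (+-monoʳ-≤ (count P? xs) (n≤1+n _)))
    ... | yes _ | no _  = s≤s (count-⊎ P? Q? xs)
    ... | no _  | yes _ rewrite +-suc (count P? xs) (count Q? xs) = s≤s (count-⊎ P? Q? xs)
    ... | no _  | no _  = count-⊎ P? Q? xs

  module _ {A B : Set} where

    count-Any : {Q : B → A → Set} (Q? : ∀ i → Decidable (Q i)) (I : List B) (xs : List A) (c : ℕ) →
      (∀ {i} → i ∈ I → count (Q? i) xs ≤ c) →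
      count (λ x → any? (λ i → Q? i x) I) xs ≤ length I * c
    count-Any Q? [] xs c _ = ≤-reflexive (none xs)
      where
        none : ∀ ys → count (λ x → any? (λ i → Q? i x) []) ys ≡ 0
        none [] = refl
        none (_ ∷ ys) = none ys
    count-Any {Q} Q? (i ∷ I) xs c bound = begin
        count (λ x → any? (λ j → Q? j x) (i ∷ I)) xs
          ≤⟨ count-mono _ _ xs split ⟩
        count (λ x → Q? i x ⊎-dec any? (λ j → Q? j x) I) xs
          ≤⟨ count-⊎ (Q? i) (λ x → any? (λ j → Q? j x) I) xs ⟩
        count (Q? i) xs + count (λ x → any? (λ j → Q? j x) I) xs
          ≤⟨ +-mono-≤ (bound (here refl)) (count-Any Q? I xs c (λ m → bound (there m))) ⟩
        c + length I * c ∎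
      where
        open ≤-Reasoning
        split : ∀ {x} → x ∈ xs → Any (λ j → Q j x) (i ∷ I) → Q i x ⊎ Any (λ j → Q j x) I
        split _ (here q) = inj₁ q
        split _ (there a) = inj₂ a

  indicator : {P : Set} → Dec P → ℕ
  indicator (yes _) = 1
  indicator (no _) = 0

  module _ {A : Set} where

    count≡sum-indicator : {P : A → Set} (P? : Decidable P) (xs : List A) →
      count P? xs ≡ sum (map (λ x → indicator (P? x)) xs)
    count≡sum-indicator P? [] = refl
    count≡sum-indicator P? (x ∷ xs) with P? x
    ... | yes _ = cong suc (count≡sum-indicator P? xs)
    ... | no _ = count≡sum-indicator P? xs

    sum-map-+ : (f g : A → ℕ) (xs : List A) →
      sum (map (λ x → f x + g x) xs) ≡ sum (map f xs) + sum (map g xs)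
    sum-map-+ f g [] = refl
    sum-map-+ f g (x ∷ xs) =
      trans (cong (f x + g x +_) (sum-map-+ f g xs)) (interchange (f x) (g x) (sum (map f xs)) (sum (map g xs)))

    sum≤length*c : (f : A → ℕ) (c : ℕ) (xs : List A) → (∀ {x} → x ∈ xs → f x ≤ c) → sum (map f xs) ≤ length xs * c
    sum≤length*c f c [] _ = z≤n
    sum≤length*c f c (x ∷ xs) bound = +-mono-≤ (bound (here refl)) (sum≤length*c f c xs (λ m → bound (there m)))

    small-term : (f : A → ℕ) (M : ℕ) (xs : List A) → 0 < length xs → sum (map f xs) ≤ length xs * M →
      Σ A λ v → v ∈ xs × f v ≤ M
    small-term f M (x ∷ xs) _ total with f x ≤? M
    ... | yes fx≤M = x , here refl , fx≤M
    small-term f M (x ∷ []) _ total | no fx≰M =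
      ⊥-elim (fx≰M (subst₂ _≤_ (+-identityʳ (f x)) (+-identityʳ M) total))
    small-term f M (x ∷ y ∷ xs) _ total | no fx≰M =
      let (v , v∈ , fv≤M) = small-term f M (y ∷ xs) (s≤s z≤n) rest in v , there v∈ , fv≤M
      where
        rest : sum (map f (y ∷ xs)) ≤ length (y ∷ xs) * M
        rest = +-cancelˡ-≤ M _ _ (≤-trans (+-monoˡ-≤ _ (<⇒≤ (≰⇒> fx≰M))) total)

    columns≡rows : {R : A → A → Set} (R? : ∀ x → Decidable (R x)) (xs ys : List A) →
      sum (map (λ v → count (λ x → R? x v) xs) ys) ≡ sum (map (λ x → count (R? x) ys) xs)
    columns≡rows R? xs [] = sym (zeros xs)
      where
        zeros : ∀ zs → sum (map (λ x → count (R? x) []) zs) ≡ 0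
        zeros [] = refl
        zeros (_ ∷ zs) = zeros zs
    columns≡rows R? xs (y ∷ ys) = begin
        count (λ x → R? x y) xs + sum (map (λ v → count (λ x → R? x v) xs) ys)
          ≡⟨ cong₂ _+_ (count≡sum-indicator (λ x → R? x y) xs) (columns≡rows R? xs ys) ⟩
        sum (map (λ x → indicator (R? x y)) xs) + sum (map (λ x → count (R? x) ys) xs)
          ≡⟨ sym (sum-map-+ (λ x → indicator (R? x y)) (λ x → count (R? x) ys) xs) ⟩
        sum (map (λ x → indicator (R? x y) + count (R? x) ys) xs)
          ≡⟨ cong sum (map-cong (λ x → sym (count-cons x)) xs) ⟩
        sum (map (λ x → count (R? x) (y ∷ ys)) xs) ∎
      where
        open ≡-Reasoning
        count-cons : ∀ x → count (R? x) (y ∷ ys) ≡ indicator (R? x y) + count (R? x) ys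
        count-cons x with R? x y
        ... | yes _ = refl
        ... | no _ = refl

    light-column : {R : A → A → Set} (R? : ∀ x → Decidable (R x)) (xs : List A) (M : ℕ) → 0 < length xs →
      (∀ {x} → x ∈ xs → count (R? x) xs ≤ M) → Σ A λ v → v ∈ xs × count (λ x → R? x v) xs ≤ M
    light-column R? xs M nonempty rows = small-term (λ v → count (λ x → R? x v) xs) M xs nonempty
      (subst (_≤ length xs * M) (sym (columns≡rows R? xs xs)) (sum≤length*c (λ x → count (R? x) xs) M xs rows))

  module _ {A B C : Set} where

    count-Any-Any : {Q : B → C → A → Set} (Q? : ∀ i γ → Decidable (Q i γ)) (I : List B) (Γ : List C) (xs : List A) →
      (∀ {i γ} → i ∈ I → γ ∈ Γ → count (Q? i γ) xs ≤ 1) →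
      count (λ x → any? (λ i → any? (λ γ → Q? i γ x) Γ) I) xs ≤ length I * length Γ
    count-Any-Any Q? I Γ xs atMostOne = count-Any (λ i x → any? (λ γ → Q? i γ x) Γ) I xs (length Γ)
      (λ {i} i∈ → ≤-trans (count-Any (Q? i) Γ xs 1 (atMostOne i∈)) (≤-reflexive (*-identityʳ (length Γ))))

open Counting

module Triples where
  open import Data.Nat using (ℕ; _≤_; _<_; _<?_)
  open import Data.Nat.Properties using (≤-refl; <⇒≤; <-trans; ≤-antisym; <-irrefl; ≮⇒≥; ≤∧≢⇒<)
  open import Data.Fin using (Fin; toℕ)
  open import Data.Fin.Properties using (toℕ-injective)
  open import Data.Sum using (_⊎_; inj₁; inj₂)
  open import Data.Product using (_×_; _,_; proj₁; proj₂)
  open import Data.Empty using (⊥-elim)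
  open import Relation.Nullary using (¬_; yes; no)
  open import Relation.Binary.PropositionalEquality using (_≡_; _≢_; ≢-sym; refl; sym; cong)

  -- Triples of elements, read as the 3-element sets they enumerate.
  Triple : Set → Set
  Triple A = A × A × A

  module _ {A : Set} where

    _∈₃_ : A → Triple A → Set
    x ∈₃ (a , b , c) = x ≡ a ⊎ x ≡ b ⊎ x ≡ c

    pattern first = inj₁ refl
    pattern second = inj₂ (inj₁ refl)
    pattern third = inj₂ (inj₂ refl)

    _⊆₃_ : Triple A → Triple A → Set
    (a , b , c) ⊆₃ t = a ∈₃ t × b ∈₃ t × c ∈₃ t

    _≅₃_ : Triple A → Triple A → Set
    s ≅₃ t = s ⊆₃ t × t ⊆₃ s

    Distinct₃ : Triple A → Set
    Distinct₃ (a , b , c) = a ≢ b × a ≢ c × b ≢ c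

    ∈₃-⊆₃ : ∀ {x} s t → x ∈₃ s → s ⊆₃ t → x ∈₃ t
    ∈₃-⊆₃ _ _ first (p , _ , _) = p
    ∈₃-⊆₃ _ _ second (_ , q , _) = q
    ∈₃-⊆₃ _ _ third (_ , _ , r) = r

    ⊆₃-refl : ∀ s → s ⊆₃ s
    ⊆₃-refl _ = first , second , third

    ⊆₃-trans : ∀ s t u → s ⊆₃ t → t ⊆₃ u → s ⊆₃ u
    ⊆₃-trans _ t u (p , q , r) t⊆u = ∈₃-⊆₃ t u p t⊆u , ∈₃-⊆₃ t u q t⊆u , ∈₃-⊆₃ t u r t⊆u

    ≅₃-refl : ∀ {s} → s ≅₃ s
    ≅₃-refl {s} = ⊆₃-refl s , ⊆₃-refl s

    ≅₃-sym : ∀ {s t} → s ≅₃ t → t ≅₃ s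
    ≅₃-sym (p , q) = q , p

    ≅₃-trans : ∀ {s t u} → s ≅₃ t → t ≅₃ u → s ≅₃ u
    ≅₃-trans {s} {t} {u} (p , p') (q , q') = ⊆₃-trans s t u p q , ⊆₃-trans u t s q' p'

    swap₁₂ : ∀ {x y z} → (x , y , z) ≅₃ (y , x , z)
    swap₁₂ = (second , first , third) , (second , first , third)

    swap₂₃ : ∀ {x y z} → (x , y , z) ≅₃ (x , z , y)
    swap₂₃ = (first , third , second) , (first , third , second)

    rotate : ∀ {x y z} → (x , y , z) ≅₃ (y , z , x)
    rotate = (third , first , second) , (second , third , first)

  module _ {n : ℕ} where

    Increasing : Triple (Fin n) → Set
    Increasing (a , b , c) = a <ꟳ b × b <ꟳ c

    <ꟳ⇒≢ : ∀ {x y : Fin n} → x <ꟳ y → x ≢ y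
    <ꟳ⇒≢ x<y refl = <-irrefl refl x<y

    increasing⇒distinct : ∀ {s} → Increasing s → Distinct₃ s
    increasing⇒distinct (a<b , b<c) = <ꟳ⇒≢ a<b , <ꟳ⇒≢ (<-trans a<b b<c) , <ꟳ⇒≢ b<c

    private
      least : ∀ {x a b c} → Increasing (a , b , c) → x ∈₃ (a , b , c) → toℕ a ≤ toℕ x
      least _ first = ≤-refl
      least (a<b , _) second = <⇒≤ a<b
      least (a<b , b<c) third = <⇒≤ (<-trans a<b b<c)

      greatest : ∀ {x a b c} → Increasing (a , b , c) → x ∈₃ (a , b , c) → toℕ x ≤ toℕ c
      greatest (a<b , b<c) first = <⇒≤ (<-trans a<b b<c)
      greatest (_ , b<c) second = <⇒≤ b<c
      greatest _ third = ≤-refl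

    -- Two increasing triples with the same 3-set coincide: compare least and greatest elements.
    increasing-unique : ∀ {s t} → Increasing s → Increasing t → s ≅₃ t → s ≡ t
    increasing-unique {a , b , c} {a' , b' , c'} inc inc' ((a∈ , b∈ , c∈) , (a'∈ , _ , c'∈))
      with toℕ-injective (≤-antisym (least inc a'∈) (least inc' a∈))
         | toℕ-injective (≤-antisym (greatest inc' c∈) (greatest inc c'∈))
    ... | refl | refl = cong (λ y → a , y , c) (middle b∈)
      where
        middle : b ∈₃ (a , b' , c) → b ≡ b'
        middle first = ⊥-elim (<ꟳ⇒≢ (proj₁ inc) refl)
        middle second = refl
        middle third = ⊥-elim (<ꟳ⇒≢ (proj₂ inc) refl)

    private
      ≢⇒>ꟳ : ∀ {x y : Fin n} → x ≢ y → ¬ (x <ꟳ y) → y <ꟳ x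
      ≢⇒>ꟳ x≢y x≮y = ≤∧≢⇒< (≮⇒≥ x≮y) (λ e → x≢y (toℕ-injective (sym e)))

      insert : Fin n → Fin n → Fin n → Triple (Fin n)
      insert a b c with toℕ b <? toℕ c | toℕ a <? toℕ c
      ... | yes _ | _ = a , b , c
      ... | no _ | yes _ = a , c , b
      ... | no _ | no _ = c , a , b

      insert-spec : ∀ a b c → a <ꟳ b → c ≢ a → c ≢ b →
        Increasing (insert a b c) × insert a b c ≅₃ (a , b , c)
      insert-spec a b c a<b c≢a c≢b with toℕ b <? toℕ c | toℕ a <? toℕ c
      ... | yes b<c | _ = (a<b , b<c) , ≅₃-refl
      ... | no b≮c | yes a<c = (a<c , ≢⇒>ꟳ (≢-sym c≢b) b≮c) , swap₂₃
      ... | no _ | no a≮c = (≢⇒>ꟳ (≢-sym c≢a) a≮c , a<b) , rotate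

    sort₃ : Triple (Fin n) → Triple (Fin n)
    sort₃ (a , b , c) with toℕ a <? toℕ b
    ... | yes _ = insert a b c
    ... | no _ = insert b a c

    sort₃-spec : ∀ s → Distinct₃ s → Increasing (sort₃ s) × sort₃ s ≅₃ s
    sort₃-spec (a , b , c) (a≢b , a≢c , b≢c) with toℕ a <? toℕ b
    ... | yes a<b = insert-spec a b c a<b (≢-sym a≢c) (≢-sym b≢c)
    ... | no a≮b with insert-spec b a c (≢⇒>ꟳ a≢b a≮b) (≢-sym b≢c) (≢-sym a≢c)
    ...   | inc , ≅bac = inc , ≅₃-trans ≅bac swap₁₂

    setColour : Col3 n → Fin n → Fin n → Fin n → ℕ
    setColour col a b c with sort₃ (a , b , c)
    ... | (x , y , z) = col x y z

    setColour-≅₃ : (col : Col3 n) → ∀ {a b c a' b' c'} → Distinct₃ (a , b , c) → Distinct₃ (a' , b' , c') →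
      (a , b , c) ≅₃ (a' , b' , c') → setColour col a b c ≡ setColour col a' b' c'
    setColour-≅₃ col {a} {b} {c} {a'} {b'} {c'} d d' s≅s'
      with sort₃ (a , b , c) | sort₃-spec (a , b , c) d | sort₃ (a' , b' , c') | sort₃-spec (a' , b' , c') d'
    ... | σ | (inc , σ≅s) | σ' | (inc' , σ'≅s')
      with increasing-unique inc inc' (≅₃-trans σ≅s (≅₃-trans s≅s' (≅₃-sym σ'≅s')))
    ... | refl = refl

    setColour-increasing : (col : Col3 n) → ∀ {a b c} → Increasing (a , b , c) → setColour col a b c ≡ col a b c
    setColour-increasing col {a} {b} {c} inc
      with sort₃ (a , b , c) | sort₃-spec (a , b , c) (increasing⇒distinct inc)
    ... | σ | (incσ , σ≅s) with increasing-unique incσ inc σ≅s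
    ... | refl = refl

open Triples

module Subsets where
  open import Data.Nat using (ℕ; zero; suc; _+_; z≤n; s≤s)
  open import Data.Nat.Properties using (+-suc; <-irrefl)
  open import Data.Bool using (Bool; true; false)
  open import Data.Fin using (Fin; zero; suc; toℕ)
  open import Data.Fin.Subset using (Subset; ∣_∣; inside; outside)
  import Data.Fin.Subset as S
  open import Data.Vec using ([]; _∷_; here; there)
  open import Data.List using (List; []; _∷_; length; map)
  open import Data.List.Properties using (length-map)
  open import Data.List.Relation.Unary.Any using (here; there)
  open import Data.List.Relation.Unary.All using (All; []; _∷_)
  import Data.List.Relation.Unary.All as All
  open import Data.List.Relation.Unary.AllPairs using (AllPairs; []; _∷_)
  import Data.List.Relation.Unary.AllPairs as AllPairs
  import Data.List.Relation.Unary.AllPairs.Properties as AllPairs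
  open import Data.List.Membership.Propositional using (_∈_)
  open import Data.List.Membership.Propositional.Properties using (∈-map⁻)
  open import Data.List.Relation.Unary.Unique.Propositional using (Unique)
  open import Data.Product using (_,_)
  open import Data.Empty using (⊥-elim)
  open import Relation.Binary.PropositionalEquality using (_≡_; _≢_; refl; sym; trans; cong; module ≡-Reasoning)

  Sorted : ∀ {n} → List (Fin n) → Set
  Sorted = AllPairs _<ꟳ_

  sorted⇒unique : ∀ {n} {xs : List (Fin n)} → Sorted xs → Unique xs
  sorted⇒unique = AllPairs.map (λ x<y x≡y → <-irrefl (cong toℕ x≡y) x<y)

  elements : ∀ {n} → Subset n → List (Fin n)
  elements [] = []
  elements (inside ∷ p) = zero ∷ map suc (elements p)
  elements (outside ∷ p) = map suc (elements p)

  elements-length : ∀ {n} (p : Subset n) → length (elements p) ≡ ∣ p ∣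
  elements-length [] = refl
  elements-length (inside ∷ p) = cong suc (trans (length-map suc (elements p)) (elements-length p))
  elements-length (outside ∷ p) = trans (length-map suc (elements p)) (elements-length p)

  elements-∈ : ∀ {n} (p : Subset n) {x} → x ∈ elements p → x S.∈ p
  elements-∈ (inside ∷ p) (here refl) = here
  elements-∈ (inside ∷ p) (there m) with ∈-map⁻ suc m
  ... | y , y∈ , refl = there (elements-∈ p y∈)
  elements-∈ (outside ∷ p) m with ∈-map⁻ suc m
  ... | y , y∈ , refl = there (elements-∈ p y∈)

  sorted-suc : ∀ {n} {xs : List (Fin n)} → Sorted xs → Sorted (map suc xs)
  sorted-suc s = AllPairs.map⁺ (AllPairs.map s≤s s)

  elements-sorted : ∀ {n} (p : Subset n) → Sorted (elements p)
  elements-sorted [] = []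
  elements-sorted (inside ∷ p) = All.tabulate zero< ∷ sorted-suc (elements-sorted p)
    where
      zero< : ∀ {y} → y ∈ map suc (elements p) → zero <ꟳ y
      zero< m with ∈-map⁻ suc m
      ... | _ , _ , refl = s≤s z≤n
  elements-sorted (outside ∷ p) = sorted-suc (elements-sorted p)

  containsZero : ∀ {n} → List (Fin (suc n)) → Bool
  containsZero [] = false
  containsZero (zero ∷ xs) = true
  containsZero (suc _ ∷ xs) = containsZero xs

  predecessors : ∀ {n} → List (Fin (suc n)) → List (Fin n)
  predecessors [] = []
  predecessors (zero ∷ xs) = predecessors xs
  predecessors (suc x ∷ xs) = x ∷ predecessors xs

  fromList : ∀ {n} → List (Fin n) → Subset n
  fromList {zero} _ = []
  fromList {suc n} xs = containsZero xs ∷ fromList (predecessors xs)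

  fromList-∈ : ∀ {n} (xs : List (Fin n)) {x} → x S.∈ fromList xs → x ∈ xs
  fromList-∈ {suc n} xs {zero} z∈ = zero-listed xs (head-inside z∈)
    where
      head-inside : ∀ {b} {p : Subset n} → zero S.∈ (b ∷ p) → b ≡ true
      head-inside here = refl
      zero-listed : ∀ ys → containsZero ys ≡ true → zero ∈ ys
      zero-listed (zero ∷ ys) _ = here refl
      zero-listed (suc _ ∷ ys) c = there (zero-listed ys c)
  fromList-∈ {suc n} xs {suc x} (there x∈) = suc-listed xs (fromList-∈ (predecessors xs) x∈)
    where
      suc-listed : ∀ ys → x ∈ predecessors ys → suc x ∈ ys
      suc-listed (zero ∷ ys) m = there (suc-listed ys m)
      suc-listed (suc _ ∷ ys) (here refl) = here refl
      suc-listed (suc _ ∷ ys) (there m) = there (suc-listed ys m)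

  fromList-size : ∀ {n} (xs : List (Fin n)) → Unique xs → ∣ fromList xs ∣ ≡ length xs
  fromList-size {zero} [] _ = refl
  fromList-size {suc n} xs u = begin
      ∣ containsZero xs ∷ fromList (predecessors xs) ∣
        ≡⟨ size-cons (containsZero xs) ⟩
      bit (containsZero xs) + ∣ fromList (predecessors xs) ∣
        ≡⟨ cong (bit (containsZero xs) +_) (fromList-size (predecessors xs) (predecessors-unique xs u)) ⟩
      bit (containsZero xs) + length (predecessors xs)
        ≡⟨ sym (split xs u) ⟩
      length xs ∎
    where
      open ≡-Reasoning
      bit : Bool → ℕ
      bit true = 1
      bit false = 0
      size-cons : ∀ b → ∣ b ∷ fromList (predecessors xs) ∣ ≡ bit b + ∣ fromList (predecessors xs) ∣
      size-cons true = refl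
      size-cons false = refl
      zero-absent : ∀ ys → All (zero ≢_) ys → containsZero ys ≡ false
      zero-absent [] [] = refl
      zero-absent (zero ∷ ys) (z≢z ∷ _) = ⊥-elim (z≢z refl)
      zero-absent (suc _ ∷ ys) (_ ∷ rest) = zero-absent ys rest
      split : ∀ ys → Unique ys → length ys ≡ bit (containsZero ys) + length (predecessors ys)
      split [] _ = refl
      split (zero ∷ ys) (fresh ∷ u') =
        cong suc (trans (split ys u') (cong (λ b → bit b + length (predecessors ys)) (zero-absent ys fresh)))
      split (suc _ ∷ ys) (_ ∷ u') = trans (cong suc (split ys u')) (sym (+-suc (bit (containsZero ys)) _))
      predecessors-unique : ∀ ys → Unique ys → Unique (predecessors ys)
      predecessors-unique [] _ = []
      predecessors-unique (zero ∷ ys) (_ ∷ u') = predecessors-unique ys u'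
      predecessors-unique (suc y ∷ ys) (fresh ∷ u') = fresh' ys fresh ∷ predecessors-unique ys u'
        where
          fresh' : ∀ zs → All (suc y ≢_) zs → All (y ≢_) (predecessors zs)
          fresh' [] [] = []
          fresh' (zero ∷ zs) (_ ∷ rest) = fresh' zs rest
          fresh' (suc z ∷ zs) (sy≢sz ∷ rest) = (λ y≡z → sy≢sz (cong suc y≡z)) ∷ fresh' zs rest

open Subsets

module Lists where
  open import Data.Nat using (ℕ; suc; _+_; _*_; _≤_; z≤n)
  open import Data.Nat.Properties using (+-monoʳ-≤; m≤n+m; *-suc; module ≤-Reasoning)
  open import Data.Product using (_×_; _,_; proj₁; proj₂)
  open import Data.List using (List; []; _∷_; length; map; _++_)
  open import Data.List.Properties using (length-map; length-++)
  open import Data.List.Relation.Unary.Any using (here; there)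
  open import Data.List.Relation.Unary.All using (All; []; _∷_)
  import Data.List.Relation.Unary.All as All
  open import Data.List.Relation.Unary.AllPairs using ([]; _∷_)
  open import Data.List.Membership.Propositional using (_∈_)
  open import Data.List.Membership.Propositional.Properties using (∈-map⁻; ∈-map⁺; ∈-++⁻; ∈-++⁺ˡ; ∈-++⁺ʳ)
  open import Data.List.Relation.Unary.Unique.Propositional using (Unique)
  open import Data.List.Relation.Binary.Disjoint.Propositional using (Disjoint)
  open import Data.Sum using (_⊎_; inj₁; inj₂)
  open import Data.Empty using (⊥-elim)
  open import Relation.Binary.PropositionalEquality using (_≡_; _≢_; refl; sym; trans; cong)

  Unique-++⁻ : {A : Set} (xs : List A) {ys : List A} → Unique (xs ++ ys) → Unique xs × Unique ys × Disjoint xs ys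
  Unique-++⁻ [] u = [] , u , λ ()
  Unique-++⁻ (x ∷ xs) {ys} (x∉ ∷ u) with Unique-++⁻ xs u
  ... | uxs , uys , disj = headFresh ∷ uxs , uys , disjoint
    where
      headFresh : All (x ≢_) xs
      headFresh = All.tabulate (λ m → All.lookup x∉ (∈-++⁺ˡ m))
      disjoint : Disjoint (x ∷ xs) ys
      disjoint (here refl , m) = All.lookup x∉ (∈-++⁺ʳ xs m) refl
      disjoint (there m₁ , m₂) = disj (m₁ , m₂)

  map⁺-on : {B C : Set} (f : B → C) {xs : List B} → Unique xs →
    (∀ {a b} → a ∈ xs → b ∈ xs → f a ≡ f b → a ≡ b) → Unique (map f xs)
  map⁺-on f {[]} [] _ = []
  map⁺-on f {x ∷ xs} (x∉ ∷ u) inj =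
    All.tabulate fresh ∷ map⁺-on f u (λ ma mb → inj (there ma) (there mb))
    where
      fresh : ∀ {c} → c ∈ map f xs → f x ≢ c
      fresh m refl with ∈-map⁻ f m
      ... | y , y∈ , fx≡fy = All.lookup x∉ y∈ (inj (here refl) (there y∈) fx≡fy)

  map⁻-on : {B C : Set} (f : B → C) (xs : List B) → Unique (map f xs) →
    ∀ {a b} → a ∈ xs → b ∈ xs → f a ≡ f b → a ≡ b
  map⁻-on f (x ∷ xs) u (here refl) (here refl) _ = refl
  map⁻-on f (x ∷ xs) (fx∉ ∷ _) (here refl) (there b∈) e = ⊥-elim (All.lookup fx∉ (∈-map⁺ f b∈) e)
  map⁻-on f (x ∷ xs) (fx∉ ∷ _) (there a∈) (here refl) e = ⊥-elim (All.lookup fx∉ (∈-map⁺ f a∈) (sym e))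
  map⁻-on f (x ∷ xs) (_ ∷ u) (there a∈) (there b∈) e = map⁻-on f xs u a∈ b∈ e

  module _ {A : Set} where

    pairs : List A → List (A × A)
    pairs [] = []
    pairs (x ∷ xs) = map (x ,_) xs ++ pairs xs

    pairs-∈ : ∀ xs → Unique xs → ∀ {p} → p ∈ pairs xs → proj₁ p ∈ xs × proj₂ p ∈ xs × proj₁ p ≢ proj₂ p
    pairs-∈ (x ∷ xs) (x∉ ∷ u) m with ∈-++⁻ (map (x ,_) xs) m
    ... | inj₂ m' = let (a∈ , b∈ , a≢b) = pairs-∈ xs u m' in there a∈ , there b∈ , a≢b
    ... | inj₁ m' with ∈-map⁻ (x ,_) m'
    ...   | y , y∈ , refl = here refl , there y∈ , All.lookup x∉ y∈

    pairs-complete : ∀ xs {a b} → a ∈ xs → b ∈ xs → a ≢ b → (a , b) ∈ pairs xs ⊎ (b , a) ∈ pairs xs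
    pairs-complete (x ∷ xs) (here refl) (here refl) a≢b = ⊥-elim (a≢b refl)
    pairs-complete (x ∷ xs) (here refl) (there b∈) _ = inj₁ (∈-++⁺ˡ (∈-map⁺ (x ,_) b∈))
    pairs-complete (x ∷ xs) (there a∈) (here refl) _ = inj₂ (∈-++⁺ˡ (∈-map⁺ (x ,_) a∈))
    pairs-complete (x ∷ xs) (there a∈) (there b∈) a≢b with pairs-complete xs a∈ b∈ a≢b
    ... | inj₁ m = inj₁ (∈-++⁺ʳ (map (x ,_) xs) m)
    ... | inj₂ m = inj₂ (∈-++⁺ʳ (map (x ,_) xs) m)

    length-pairs : ∀ xs → length (pairs xs) ≤ length xs * length xs
    length-pairs [] = z≤n
    length-pairs (x ∷ xs) = begin
        length (map (x ,_) xs ++ pairs xs)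
          ≡⟨ trans (length-++ (map (x ,_) xs)) (cong (_+ length (pairs xs)) (length-map _ xs)) ⟩
        t + length (pairs xs)
          ≤⟨ +-monoʳ-≤ t (length-pairs xs) ⟩
        t + t * t
          ≤⟨ m≤n+m _ (suc t) ⟩
        suc t + (t + t * t)
          ≡⟨ cong (suc t +_) (sym (*-suc t t)) ⟩
        suc t * suc t ∎
      where
        open ≤-Reasoning
        t : ℕ
        t = length xs

open Lists

module Rainbow {A : Set} (_≟_ : DecidableEquality A) (χ : A → A → A → ℕ)
  (χ-≅₃ : ∀ {a b c a' b' c'} → Distinct₃ (a , b , c) → Distinct₃ (a' , b' , c') →
          (a , b , c) ≅₃ (a' , b' , c') → χ a b c ≡ χ a' b' c') where
  open import Data.Nat using (ℕ; zero; suc; _+_; _*_; _^_; _≤_; _<_; z≤n; s≤s) renaming (_≟_ to _≟ℕ_)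
  open import Data.Product using (_×_; _,_; proj₁; proj₂; Σ)
  open import Relation.Binary.PropositionalEquality using (_≡_; _≢_; ≢-sym; refl; sym; trans; cong; subst)
  open import Data.Nat.Properties hiding (_≟_)
  open import Data.List using (List; []; _∷_; length; map; _++_; filter)
  open import Data.List.Properties using (map-++; map-∘; length-map; length-++; ++-assoc)
  open import Data.List.Relation.Unary.Any using (Any; here; there; any?)
  open import Data.List.Relation.Unary.All using (All; []; _∷_)
  import Data.List.Relation.Unary.All as All
  open import Data.List.Relation.Unary.AllPairs using ([]; _∷_)
  open import Data.List.Membership.Propositional using (_∈_; lose)
  open import Data.List.Membership.Propositional.Properties using (∈-map⁻; ∈-map⁺; ∈-++⁻; ∈-++⁺ˡ; ∈-++⁺ʳ; ∈-filter⁻)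
  open import Data.List.Relation.Unary.Unique.Propositional using (Unique)
  import Data.List.Relation.Unary.Unique.Propositional.Properties as Unique
  open import Data.List.Relation.Binary.Disjoint.Propositional using (Disjoint)
  open import Data.Sum using (_⊎_; inj₁; inj₂)
  open import Data.Empty using (⊥-elim)
  open import Relation.Nullary using (¬_; ¬?)
  open import Relation.Nullary.Decidable using (_×-dec_; _⊎-dec_)
  open import Relation.Unary using (Decidable)

  through : A → List A → List ℕ
  through x xs = map (λ p → χ x (proj₁ p) (proj₂ p)) (pairs xs)

  colours : List A → List ℕ
  colours [] = []
  colours (x ∷ xs) = through x xs ++ colours xs

  Good : List A → Set
  Good xs = Unique (colours xs)

  SetRainbow : List A → Set
  SetRainbow xs = ∀ {a b c d e f} → a ∈ xs → b ∈ xs → c ∈ xs → d ∈ xs → e ∈ xs → f ∈ xs →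
    Distinct₃ (a , b , c) → Distinct₃ (d , e , f) → χ a b c ≡ χ d e f → (a , b , c) ≅₃ (d , e , f)

  length-through : ∀ x xs → length (through x xs) ≤ length xs * length xs
  length-through x xs = ≤-trans (≤-reflexive (length-map _ (pairs xs))) (length-pairs xs)

  length-colours : ∀ xs → length (colours xs) ≤ length xs * length xs * length xs
  length-colours [] = z≤n
  length-colours (x ∷ xs) = begin
      length (through x xs ++ colours xs)
        ≡⟨ length-++ (through x xs) ⟩
      length (through x xs) + length (colours xs)
        ≤⟨ +-mono-≤ (length-through x xs) (length-colours xs) ⟩
      t * t + t * t * t
        ≤⟨ m≤m+n _ (1 + 3 * t + 2 * t * t) ⟩
      t * t + t * t * t + (1 + 3 * t + 2 * t * t)
        ≡⟨ cube-expansion t ⟩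
      suc t * suc t * suc t ∎
    where
      open ≤-Reasoning
      open import Data.Nat.Tactic.RingSolver using (solve-∀)
      t : ℕ
      t = length xs
      cube-expansion : ∀ t → t * t + t * t * t + (1 + 3 * t + 2 * t * t) ≡ suc t * suc t * suc t
      cube-expansion = solve-∀

  data View (z : A) (xs : List A) (a b c : A) : Set where
    in-tail : a ∈ xs → b ∈ xs → c ∈ xs → View z xs a b c
    at-head : ∀ {p} → p ∈ pairs xs → (a , b , c) ≅₃ (z , proj₁ p , proj₂ p) → View z xs a b c

  view : ∀ z xs {a b c} → a ∈ z ∷ xs → b ∈ z ∷ xs → c ∈ z ∷ xs → Distinct₃ (a , b , c) → View z xs a b c
  view z xs (there a∈) (there b∈) (there c∈) _ = in-tail a∈ b∈ c∈
  view z xs (here refl) (here refl) _ (a≢b , _ , _) = ⊥-elim (a≢b refl)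
  view z xs (here refl) _ (here refl) (_ , a≢c , _) = ⊥-elim (a≢c refl)
  view z xs _ (here refl) (here refl) (_ , _ , b≢c) = ⊥-elim (b≢c refl)
  view z xs (here refl) (there b∈) (there c∈) (_ , _ , b≢c) with pairs-complete xs b∈ c∈ b≢c
  ... | inj₁ m = at-head m ≅₃-refl
  ... | inj₂ m = at-head m swap₂₃
  view z xs (there a∈) (here refl) (there c∈) (_ , a≢c , _) with pairs-complete xs a∈ c∈ a≢c
  ... | inj₁ m = at-head m swap₁₂
  ... | inj₂ m = at-head m (≅₃-trans swap₁₂ swap₂₃)
  view z xs (there a∈) (there b∈) (here refl) (a≢b , _ , _) with pairs-complete xs a∈ b∈ a≢b
  ... | inj₁ m = at-head m (≅₃-sym rotate)
  ... | inj₂ m = at-head m (≅₃-trans (≅₃-sym rotate) swap₂₃)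

  pair-colour : ∀ z xs → Unique (z ∷ xs) → ∀ {a b c p} → Distinct₃ (a , b , c) → p ∈ pairs xs →
    (a , b , c) ≅₃ (z , proj₁ p , proj₂ p) → χ a b c ≡ χ z (proj₁ p) (proj₂ p)
  pair-colour z xs (z∉ ∷ u) d p∈ s≅ =
    let (p₁∈ , p₂∈ , p₁≢p₂) = pairs-∈ xs u p∈
    in χ-≅₃ d (All.lookup z∉ p₁∈ , All.lookup z∉ p₂∈ , p₁≢p₂) s≅

  ∈-through : ∀ z xs → Unique (z ∷ xs) → ∀ {a b c p} → Distinct₃ (a , b , c) → p ∈ pairs xs →
    (a , b , c) ≅₃ (z , proj₁ p , proj₂ p) → χ a b c ∈ through z xs
  ∈-through z xs u d p∈ s≅ =
    subst (_∈ through z xs) (sym (pair-colour z xs u d p∈ s≅)) (∈-map⁺ (λ q → χ z (proj₁ q) (proj₂ q)) p∈)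

  ∈-colours : ∀ xs → Unique xs → ∀ {a b c} → a ∈ xs → b ∈ xs → c ∈ xs → Distinct₃ (a , b , c) →
    χ a b c ∈ colours xs
  ∈-colours (z ∷ xs) u@(_ ∷ u') a∈ b∈ c∈ d with view z xs a∈ b∈ c∈ d
  ... | in-tail a∈' b∈' c∈' = ∈-++⁺ʳ (through z xs) (∈-colours xs u' a∈' b∈' c∈' d)
  ... | at-head p∈ s≅ = ∈-++⁺ˡ (∈-through z xs u d p∈ s≅)

  good⇒rainbow : ∀ xs → Unique xs → Good xs → SetRainbow xs
  good⇒rainbow (z ∷ xs) u@(_ ∷ u') good a∈ b∈ c∈ d∈ e∈ f∈ d₁ d₂ same
    with Unique-++⁻ (through z xs) good | view z xs a∈ b∈ c∈ d₁ | view z xs d∈ e∈ f∈ d₂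
  ... | _ , goodxs , _ | in-tail a∈' b∈' c∈' | in-tail d∈' e∈' f∈' =
    good⇒rainbow xs u' goodxs a∈' b∈' c∈' d∈' e∈' f∈' d₁ d₂ same
  ... | _ , _ , disjoint | in-tail a∈' b∈' c∈' | at-head q∈ t≅ =
    ⊥-elim (disjoint (subst (_∈ through z xs) (sym same) (∈-through z xs u d₂ q∈ t≅) , ∈-colours xs u' a∈' b∈' c∈' d₁))
  ... | _ , _ , disjoint | at-head p∈ s≅ | in-tail d∈' e∈' f∈' =
    ⊥-elim (disjoint (subst (_∈ through z xs) same (∈-through z xs u d₁ p∈ s≅) , ∈-colours xs u' d∈' e∈' f∈' d₂))
  ... | uniqueThrough , _ , _ | at-head p∈ s≅ | at-head q∈ t≅
    with map⁻-on (λ r → χ z (proj₁ r) (proj₂ r)) (pairs xs) uniqueThrough p∈ q∈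
           (trans (sym (pair-colour z xs u d₁ p∈ s≅)) (trans same (pair-colour z xs u d₂ q∈ t≅)))
  ... | refl = ≅₃-trans s≅ (≅₃-sym t≅)

  SharedPairInjective : List A → Set
  SharedPairInjective V = ∀ {a b c d} → a ∈ V → b ∈ V → c ∈ V → d ∈ V →
    a ≢ b → a ≢ c → a ≢ d → b ≢ c → b ≢ d → χ a b c ≡ χ a b d → c ≡ d

  rotate-colour : ∀ {x a b} → x ≢ a → x ≢ b → a ≢ b → χ x a b ≡ χ a b x
  rotate-colour x≢a x≢b a≢b = χ-≅₃ (x≢a , x≢b , a≢b) (a≢b , ≢-sym x≢a , ≢-sym x≢b) rotate

  swap-colour : ∀ {x a b} → x ≢ a → x ≢ b → a ≢ b → χ x a b ≡ χ x b a
  swap-colour x≢a x≢b a≢b = χ-≅₃ (x≢a , x≢b , a≢b) (x≢b , x≢a , ≢-sym a≢b) swap₂₃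

  through-cons : ∀ x v T → through x (v ∷ T) ≡ map (χ x v) T ++ through x T
  through-cons x v T = trans (map-++ _ (map (v ,_) T) (pairs T)) (cong (_++ through x T) (sym (map-∘ T)))

  -- An upper bound on the candidates lost when a point is added to a list of length t.
  loss : ℕ → ℕ
  loss t = 1 + (t * t * (t * t) + (t * (t * t) + (t * (t * t * t) + t * (t * t))))

  -- The loss of a step is paid for by the growth of t ^ 5.
  loss+t⁵≤[1+t]⁵ : ∀ t → loss t + t ^ 5 ≤ suc t ^ 5
  loss+t⁵≤[1+t]⁵ t = subst (loss t + t ^ 5 ≤_) (sym (expansion t)) (m≤m+n _ _)
    where
      open import Data.Nat.Tactic.RingSolver using (solve-∀)
      -- Both powers are written as the products they unfold to.
      expansion : ∀ t → (1 + t) * ((1 + t) * ((1 + t) * ((1 + t) * ((1 + t) * 1)))) ≡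
        (1 + (t * t * (t * t) + (t * (t * t) + (t * (t * t * t) + t * (t * t)))) + t * (t * (t * (t * (t * 1)))))
        + (3 * t * t * t * t + 8 * t * t * t + 10 * t * t + 5 * t)
      expansion = solve-∀

  module Collisions (T : List A) where

    -- Ways in which adding x after v to T can repeat a colour (the others are excluded by Pool and shared):
    -- {x,a,b} against {v,c,d}, {x,v,a} against {v,c,d}, {x,v,a} against a 3-set of T,
    -- and {x,v,a} against {x,c,d}.
    Clash₁ Clash₂ Clash₃ : A → A → Set
    Clash₁ v x = Any (λ p → Any (λ γ → χ x (proj₁ p) (proj₂ p) ≡ γ) (through v T)) (pairs T)
    Clash₂ v x = Any (λ a → Any (λ γ → x ≢ v × χ x v a ≡ γ) (through v T)) T
    Clash₃ v x = Any (λ a → Any (λ γ → x ≢ v × χ x v a ≡ γ) (colours T)) T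

    -- Written with x first: it is counted over v for each fixed x.
    Clash₄ : A → A → Set
    Clash₄ x v = Any (λ a → Any (λ γ → v ≢ x × χ x v a ≡ γ) (through x T)) T

    Clash₁? : ∀ v → Decidable (Clash₁ v)
    Clash₁? v x = any? (λ p → any? (λ γ → χ x (proj₁ p) (proj₂ p) ≟ℕ γ) (through v T)) (pairs T)
    Clash₂? : ∀ v → Decidable (Clash₂ v)
    Clash₂? v x = any? (λ a → any? (λ γ → ¬? (x ≟ v) ×-dec (χ x v a ≟ℕ γ)) (through v T)) T
    Clash₃? : ∀ v → Decidable (Clash₃ v)
    Clash₃? v x = any? (λ a → any? (λ γ → ¬? (x ≟ v) ×-dec (χ x v a ≟ℕ γ)) (colours T)) T

    Clash₄? : ∀ x → Decidable (Clash₄ x)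
    Clash₄? x v = any? (λ a → any? (λ γ → ¬? (v ≟ x) ×-dec (χ x v a ≟ℕ γ)) (through x T)) T

  -- The greedy construction inside a set V on which shared pairs determine colours: a good list T grows
  -- one point at a time, while a pool P of candidates x with x ∷ T good shrinks by at most loss |T|.
  module Greedy (V : List A) (shared : SharedPairInjective V) where

    record Pool (T P : List A) : Set where
      field
        T-unique : Unique T
        T⊆V : ∀ {x} → x ∈ T → x ∈ V
        T-good : Good T
        P-unique : Unique P
        P⊆V : ∀ {x} → x ∈ P → x ∈ V
        P-fresh : ∀ {x a} → x ∈ P → a ∈ T → a ≢ x
        P-good : ∀ {x} → x ∈ P → Good (x ∷ T)

    module Step {T P : List A} (pool : Pool T P) where
      open Pool pool
      open Collisions T

      t : ℕ
      t = length T

      -- Each kind of collision is witnessed by at most one candidate per (point or pair, colour).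
      pair-apex-unique : ∀ {p x y} → p ∈ pairs T → x ∈ P → y ∈ P →
        χ x (proj₁ p) (proj₂ p) ≡ χ y (proj₁ p) (proj₂ p) → x ≡ y
      pair-apex-unique p∈ x∈ y∈ same =
        let (a∈ , b∈ , a≢b) = pairs-∈ T T-unique p∈
            a≢x = P-fresh x∈ a∈ ; a≢y = P-fresh y∈ a∈ ; b≢x = P-fresh x∈ b∈ ; b≢y = P-fresh y∈ b∈
        in shared (T⊆V a∈) (T⊆V b∈) (P⊆V x∈) (P⊆V y∈) a≢b a≢x a≢y b≢x b≢y
             (trans (sym (rotate-colour (≢-sym a≢x) (≢-sym b≢x) a≢b)) (trans same (rotate-colour (≢-sym a≢y) (≢-sym b≢y) a≢b)))

      apex-unique : ∀ {v a x y} → v ∈ P → a ∈ T → x ∈ P → y ∈ P → x ≢ v → y ≢ v → χ x v a ≡ χ y v a → x ≡ y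
      apex-unique v∈ a∈ x∈ y∈ x≢v y≢v same =
        let a≢v = P-fresh v∈ a∈ ; a≢x = P-fresh x∈ a∈ ; a≢y = P-fresh y∈ a∈
        in shared (P⊆V v∈) (T⊆V a∈) (P⊆V x∈) (P⊆V y∈) (≢-sym a≢v) (≢-sym x≢v) (≢-sym y≢v) a≢x a≢y
             (trans (sym (rotate-colour x≢v (≢-sym a≢x) (≢-sym a≢v))) (trans same (rotate-colour y≢v (≢-sym a≢y) (≢-sym a≢v))))

      middle-unique : ∀ {x a v w} → x ∈ P → a ∈ T → v ∈ P → w ∈ P → v ≢ x → w ≢ x → χ x v a ≡ χ x w a → v ≡ w
      middle-unique x∈ a∈ v∈ w∈ v≢x w≢x same =
        let a≢x = P-fresh x∈ a∈ ; a≢v = P-fresh v∈ a∈ ; a≢w = P-fresh w∈ a∈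
        in shared (P⊆V x∈) (T⊆V a∈) (P⊆V v∈) (P⊆V w∈) (≢-sym a≢x) (≢-sym v≢x) (≢-sym w≢x) a≢v a≢w
             (trans (sym (swap-colour (≢-sym v≢x) (≢-sym a≢x) (≢-sym a≢v))) (trans same (swap-colour (≢-sym w≢x) (≢-sym a≢x) (≢-sym a≢w))))

      clash₁-count : ∀ v → count (Clash₁? v) P ≤ length (pairs T) * length (through v T)
      clash₁-count v = count-Any-Any (λ p γ x → χ x (proj₁ p) (proj₂ p) ≟ℕ γ) (pairs T) (through v T) P
        (λ p∈ _ → count≤1 _ P-unique (λ x∈ y∈ ex ey → pair-apex-unique p∈ x∈ y∈ (trans ex (sym ey))))

      clash₂-count : ∀ {v} → v ∈ P → count (Clash₂? v) P ≤ t * length (through v T)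
      clash₂-count {v} v∈ = count-Any-Any (λ a γ x → ¬? (x ≟ v) ×-dec (χ x v a ≟ℕ γ)) T (through v T) P
        (λ a∈ _ → count≤1 _ P-unique (λ x∈ y∈ (x≢v , ex) (y≢v , ey) → apex-unique v∈ a∈ x∈ y∈ x≢v y≢v (trans ex (sym ey))))

      clash₃-count : ∀ {v} → v ∈ P → count (Clash₃? v) P ≤ t * length (colours T)
      clash₃-count {v} v∈ = count-Any-Any (λ a γ x → ¬? (x ≟ v) ×-dec (χ x v a ≟ℕ γ)) T (colours T) P
        (λ a∈ _ → count≤1 _ P-unique (λ x∈ y∈ (x≢v , ex) (y≢v , ey) → apex-unique v∈ a∈ x∈ y∈ x≢v y≢v (trans ex (sym ey))))

      clash₄-row : ∀ {x} → x ∈ P → count (Clash₄? x) P ≤ t * length (through x T)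
      clash₄-row {x} x∈ = count-Any-Any (λ a γ v → ¬? (v ≟ x) ×-dec (χ x v a ≟ℕ γ)) T (through x T) P
        (λ a∈ _ → count≤1 _ P-unique (λ v∈ w∈ (v≢x , ev) (w≢x , ew) → middle-unique x∈ a∈ v∈ w∈ v≢x w≢x (trans ev (sym ew))))

      extend-good : ∀ {x v} → x ∈ P → v ∈ P → x ≢ v →
        ¬ Clash₁ v x → ¬ Clash₂ v x → ¬ Clash₃ v x → ¬ Clash₄ x v → Good (x ∷ v ∷ T)
      -- The colours of x ∷ v ∷ T are those of the 3-sets {x,v,a}, of {x,a,b} and of v ∷ T: each part
      -- is duplicate-free and the parts are pairwise disjoint.
      extend-good {x} {v} x∈ v∈ x≢v no₁ no₂ no₃ no₄ =
        subst Unique (sym layout) (Unique.++⁺ newUnique (Unique.++⁺ (proj₁ xParts) (P-good v∈) xDisjoint) newDisjoint)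
        where
          layout : colours (x ∷ v ∷ T) ≡ map (χ x v) T ++ (through x T ++ (through v T ++ colours T))
          layout = trans (cong (_++ (through v T ++ colours T)) (through-cons x v T))
                         (++-assoc (map (χ x v) T) (through x T) (through v T ++ colours T))
          xParts : Unique (through x T) × Unique (colours T) × Disjoint (through x T) (colours T)
          xParts = Unique-++⁻ (through x T) (P-good x∈)
          newUnique : Unique (map (χ x v) T)
          newUnique = map⁺-on (χ x v) T-unique (λ a∈ b∈ same →
            shared (P⊆V x∈) (P⊆V v∈) (T⊆V a∈) (T⊆V b∈) x≢v (≢-sym (P-fresh x∈ a∈)) (≢-sym (P-fresh x∈ b∈))
                   (≢-sym (P-fresh v∈ a∈)) (≢-sym (P-fresh v∈ b∈)) same)
          xDisjoint : Disjoint (through x T) (through v T ++ colours T)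
          xDisjoint (γ∈x , γ∈rest) with ∈-++⁻ (through v T) γ∈rest
          ... | inj₂ γ∈T = proj₂ (proj₂ xParts) (γ∈x , γ∈T)
          ... | inj₁ γ∈v with ∈-map⁻ (λ p → χ x (proj₁ p) (proj₂ p)) γ∈x
          ...   | p , p∈ , refl = no₁ (lose p∈ (lose γ∈v refl))
          newDisjoint : Disjoint (map (χ x v) T) (through x T ++ (through v T ++ colours T))
          newDisjoint (γ∈new , γ∈rest) with ∈-map⁻ (χ x v) γ∈new
          ... | a , a∈ , refl with ∈-++⁻ (through x T) γ∈rest
          ...   | inj₁ γ∈x = no₄ (lose a∈ (lose γ∈x (≢-sym x≢v , refl)))
          ...   | inj₂ γ∈rest' with ∈-++⁻ (through v T) γ∈rest'
          ...     | inj₁ γ∈v = no₂ (lose a∈ (lose γ∈v (x≢v , refl)))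
          ...     | inj₂ γ∈T = no₃ (lose a∈ (lose γ∈T (x≢v , refl)))

      Bad : A → A → Set
      Bad v x = x ≡ v ⊎ Clash₁ v x ⊎ Clash₂ v x ⊎ Clash₃ v x ⊎ Clash₄ x v

      Bad? : ∀ v → Decidable (Bad v)
      Bad? v x = (x ≟ v) ⊎-dec (Clash₁? v x ⊎-dec (Clash₂? v x ⊎-dec (Clash₃? v x ⊎-dec Clash₄? x v)))

      bad-count : ∀ {v} → v ∈ P → count (λ x → Clash₄? x v) P ≤ t * (t * t) → count (Bad? v) P ≤ loss t
      bad-count {v} v∈ light =
        ≤-trans (count-⊎ (_≟ v) _ P) (+-mono-≤ only-v
        (≤-trans (count-⊎ (Clash₁? v) _ P) (+-mono-≤ bound₁
        (≤-trans (count-⊎ (Clash₂? v) _ P) (+-mono-≤ bound₂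
        (≤-trans (count-⊎ (Clash₃? v) _ P) (+-mono-≤ bound₃ light)))))))
        where
          only-v : count (_≟ v) P ≤ 1
          only-v = count≤1 (_≟ v) P-unique (λ _ _ x≡v y≡v → trans x≡v (sym y≡v))
          bound₁ : count (Clash₁? v) P ≤ t * t * (t * t)
          bound₁ = ≤-trans (clash₁-count v) (*-mono-≤ (length-pairs T) (length-through v T))
          bound₂ : count (Clash₂? v) P ≤ t * (t * t)
          bound₂ = ≤-trans (clash₂-count v∈) (*-monoʳ-≤ t (length-through v T))
          bound₃ : count (Clash₃? v) P ≤ t * (t * t * t)
          bound₃ = ≤-trans (clash₃-count v∈) (*-monoʳ-≤ t (length-colours T))

      -- One greedy step: a point v of the pool, chosen so that few candidates clash with it in the
      -- fourth way, moves to T, and the bad candidates are discarded.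
      step : 0 < length P → Σ A λ v → Σ (List A) λ P' → Pool (v ∷ T) P' × length P ≤ length P' + loss t
      step nonempty with light-column Clash₄? P (t * (t * t)) nonempty
                           (λ x∈ → ≤-trans (clash₄-row x∈) (*-monoʳ-≤ t (length-through _ T)))
      ... | v , v∈ , light = v , P' , pool' , size
        where
          P' : List A
          P' = filter (λ x → ¬? (Bad? v x)) P
          kept : ∀ {x} → x ∈ P' → x ∈ P × ¬ Bad v x
          kept = ∈-filter⁻ (λ x → ¬? (Bad? v x))
          pool' : Pool (v ∷ T) P'
          pool' = record
            { T-unique = All.tabulate (λ a∈ → ≢-sym (P-fresh v∈ a∈)) ∷ T-unique
            ; T⊆V = λ { (here refl) → P⊆V v∈ ; (there a∈) → T⊆V a∈ }
            ; T-good = P-good v∈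
            ; P-unique = Unique.filter⁺ (λ x → ¬? (Bad? v x)) P-unique
            ; P⊆V = λ x∈ → P⊆V (proj₁ (kept x∈))
            ; P-fresh = λ { x∈ (here refl) refl → proj₂ (kept x∈) (inj₁ refl)
                          ; x∈ (there a∈) → P-fresh (proj₁ (kept x∈)) a∈ }
            ; P-good = λ x∈ → let (x∈P , notBad) = kept x∈ in
                extend-good x∈P v∈ (λ e → notBad (inj₁ e)) (λ c → notBad (inj₂ (inj₁ c)))
                  (λ c → notBad (inj₂ (inj₂ (inj₁ c)))) (λ c → notBad (inj₂ (inj₂ (inj₂ (inj₁ c)))))
                  (λ c → notBad (inj₂ (inj₂ (inj₂ (inj₂ c)))))
            }
          size : length P ≤ length P' + loss t
          size = ≤-trans (length≤count+count¬ (Bad? v) P)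
                   (≤-trans (≤-reflexive (+-comm (count (Bad? v) P) (length P'))) (+-monoʳ-≤ (length P') (bad-count v∈ light)))

    pool-nonempty : ∀ p t d → (t + suc d) ^ 5 ≤ p + t ^ 5 → 0 < p
    pool-nonempty zero t d budget = ⊥-elim (<⇒≱ (^-monoˡ-< 5 (m<m+n t (s≤s z≤n))) budget)
    pool-nonempty (suc p) t d _ = s≤s z≤n

    budget-step : ∀ t d p p' → (t + suc d) ^ 5 ≤ p + t ^ 5 → p ≤ p' + loss t → (suc t + d) ^ 5 ≤ p' + suc t ^ 5
    budget-step t d p p' budget size = begin
      (suc t + d) ^ 5              ≡⟨ cong (_^ 5) (sym (+-suc t d)) ⟩
      (t + suc d) ^ 5              ≤⟨ budget ⟩
      p + t ^ 5                    ≤⟨ +-monoˡ-≤ (t ^ 5) size ⟩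
      p' + loss t + t ^ 5          ≡⟨ +-assoc p' (loss t) (t ^ 5) ⟩
      p' + (loss t + t ^ 5)        ≤⟨ +-monoʳ-≤ p' (loss+t⁵≤[1+t]⁵ t) ⟩
      p' + suc t ^ 5               ∎
      where open ≤-Reasoning

    Extracted : ℕ → Set
    Extracted k = Σ (List A) λ T → Unique T × (∀ {x} → x ∈ T → x ∈ V) × length T ≡ k × Good T

    grow : ∀ d {T P} → Pool T P → (length T + d) ^ 5 ≤ length P + length T ^ 5 → Extracted (length T + d)
    grow zero {T} pool _ = T , T-unique , T⊆V , sym (+-identityʳ (length T)) , T-good
      where open Pool pool
    grow (suc d) {T} {P} pool budget = continue (Step.step pool (pool-nonempty (length P) (length T) d budget))
      where
        continue : (Σ A λ v → Σ (List A) λ P' → Pool (v ∷ T) P' × length P ≤ length P' + loss (length T)) →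
          Extracted (length T + suc d)
        continue (v , P' , pool' , size) =
          let (T' , unique , ⊆V , len , good) = grow d pool' (budget-step (length T) d (length P) (length P') budget size)
          in T' , unique , ⊆V , trans len (sym (+-suc (length T) d)) , good

    extract : ∀ k → Unique V → k ^ 5 ≤ length V →
      Σ (List A) λ T → Unique T × (∀ {x} → x ∈ T → x ∈ V) × length T ≡ k × SetRainbow T
    extract k V-unique big =
      let (T , unique , ⊆V , len , good) = grow k initial (≤-trans big (≤-reflexive (sym (+-identityʳ (length V)))))
      in T , unique , ⊆V , len , good⇒rainbow T unique good
      where
        initial : Pool [] V
        initial = record { T-unique = [] ; T⊆V = λ () ; T-good = [] ; P-unique = V-unique ; P⊆V = λ x∈ → x∈
                         ; P-fresh = λ _ () ; P-good = λ _ → [] }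

module Classes where
  open import Data.Nat using (ℕ; zero; suc; _+_; _^_; _≤_; s≤s; _≤?_)
  open import Data.Nat.Properties using (<-trans; <-cmp; ≤-reflexive; +-monoˡ-≤; m≤m+n; ≤-pred; ≰⇒>; m≤n⇒m⊓n≡m)
  import Data.Nat as ℕ
  open import Data.Fin using (Fin; zero; suc; toℕ)
  import Data.Fin as Fin
  open import Data.Fin.Properties using (toℕ-injective)
  open import Data.Fin.Subset using (Subset; ∣_∣; inside; outside)
  import Data.Fin.Subset as S
  open import Data.Vec using ([]; _∷_; here; there)
  open import Data.List using (List; []; _∷_; length; take)
  open import Data.List.Properties using (length-take)
  open import Data.List.Relation.Unary.Any using (here; there)
  open import Data.List.Relation.Unary.AllPairs using ([]; _∷_)
  open import Data.List.Relation.Unary.All using ([]; _∷_)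
  open import Data.List.Membership.Propositional using (_∈_)
  import Data.List.Relation.Unary.Unique.Propositional.Properties as Unique
  open import Data.Sum using (_⊎_; inj₁; inj₂; [_,_])
  open import Data.Product using (Σ; _×_; _,_; proj₁; proj₂)
  open import Data.Empty using (⊥; ⊥-elim)
  open import Relation.Nullary using (yes; no)
  open import Relation.Binary using (tri<; tri≈; tri>)
  open import Relation.Binary.PropositionalEquality using (_≡_; _≢_; ≢-sym; refl; sym; trans; cong; subst)

  -- The four colours of the 3-subsets of a 4-set w < x < y < z are named by the point they miss:
  -- A = COL w x y, B = COL w x z, C = COL w y z, D = COL x y z.
  record AllDistinct (A B C D : ℕ) : Set where
    field
      A≢B : A ≢ B
      A≢C : A ≢ C
      A≢D : A ≢ D
      B≢C : B ≢ C
      B≢D : B ≢ D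
      C≢D : C ≢ D

  -- The seven classes of the 4-colouring. Each of the classes 0-5 records one equality among
  -- A, B, C, D (and, where the argument needs it, one inequality); class 6 records that none holds.
  Class : Fin 7 → ℕ → ℕ → ℕ → ℕ → Set
  Class zero A B C D = A ≡ B
  Class (suc zero) A B C D = A ≡ C × A ≢ B
  Class (suc (suc zero)) A B C D = B ≡ D × B ≢ C
  Class (suc (suc (suc zero))) A B C D = B ≡ C
  Class (suc (suc (suc (suc zero)))) A B C D = A ≡ D × A ≢ B
  Class (suc (suc (suc (suc (suc zero))))) A B C D = C ≡ D
  Class (suc (suc (suc (suc (suc (suc zero)))))) A B C D = AllDistinct A B C D

  classify : ∀ A B C D → Σ (Fin 7) λ i → Class i A B C D
  classify A B C D with A ℕ.≟ B
  ... | yes A≡B = zero , A≡B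
  ... | no A≢B with B ℕ.≟ C
  ...   | yes B≡C = suc (suc (suc zero)) , B≡C
  ...   | no B≢C with C ℕ.≟ D
  ...     | yes C≡D = suc (suc (suc (suc (suc zero)))) , C≡D
  ...     | no C≢D with A ℕ.≟ C
  ...       | yes A≡C = suc zero , A≡C , A≢B
  ...       | no A≢C with B ℕ.≟ D
  ...         | yes B≡D = suc (suc zero) , B≡D , B≢C
  ...         | no B≢D with A ℕ.≟ D
  ...           | yes A≡D = suc (suc (suc (suc zero))) , A≡D , A≢B
  ...           | no A≢D = suc (suc (suc (suc (suc (suc zero))))) ,
                           record { A≢B = A≢B ; A≢C = A≢C ; A≢D = A≢D ; B≢C = B≢C ; B≢D = B≢D ; C≢D = C≢D }

  module _ {n : ℕ} (col : Col3 n) where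

    classColouring : Col4 n 7
    classColouring a b c d = proj₁ (classify (col a b c) (col a b d) (col a c d) (col b c d))

    Homogeneous : Subset n → Fin 7 → Set
    Homogeneous V i = ∀ (x₁ x₂ x₃ x₄ : Fin n) → x₁ S.∈ V → x₂ S.∈ V → x₃ S.∈ V → x₄ S.∈ V →
      x₁ <ꟳ x₂ → x₂ <ꟳ x₃ → x₃ <ꟳ x₄ → classColouring x₁ x₂ x₃ x₄ ≡ i

    class-of : ∀ {V i} → Homogeneous V i → ∀ {a b c d} → a S.∈ V → b S.∈ V → c S.∈ V → d S.∈ V →
      a <ꟳ b → b <ꟳ c → c <ꟳ d → Class i (col a b c) (col a b d) (col a c d) (col b c d)
    class-of hom {a} {b} {c} {d} a∈ b∈ c∈ d∈ a<b b<c c<d =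
      subst (λ j → Class j (col a b c) (col a b d) (col a c d) (col b c d))
        (hom a b c d a∈ b∈ c∈ d∈ a<b b<c c<d) (proj₂ (classify (col a b c) (col a b d) (col a c d) (col b c d)))

    -- Classes 0, 3 and 5: the colour ignores the third, second or first point respectively.
    I₁₂ I₁₃ I₂₃ : Subset 3
    I₁₂ = inside ∷ inside ∷ outside ∷ []
    I₁₃ = inside ∷ outside ∷ inside ∷ []
    I₂₃ = outside ∷ inside ∷ inside ∷ []

    whomog₁₂ : ∀ {V} → Homogeneous V zero → Whomog col V
    whomog₁₂ {V} hom = I₁₂ , (suc (suc zero) , λ { (there (there ())) }) , same
      where
        same : IWhomog col I₁₂ V
        same x₁ x₂ x₃ y₁ y₂ y₃ x₁∈ x₂∈ x₃∈ x₁<x₂ x₂<x₃ _ _ y₃∈ _ y₂<y₃ agree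
          with agree zero here | agree (suc zero) (there here)
        ... | refl | refl with <-cmp (toℕ x₃) (toℕ y₃)
        ...   | tri< x₃<y₃ _ _ = class-of hom x₁∈ x₂∈ x₃∈ y₃∈ x₁<x₂ x₂<x₃ x₃<y₃
        ...   | tri≈ _ x₃≡y₃ _ = cong (col x₁ x₂) (toℕ-injective x₃≡y₃)
        ...   | tri> _ _ y₃<x₃ = sym (class-of hom x₁∈ x₂∈ y₃∈ x₃∈ x₁<x₂ y₂<y₃ y₃<x₃)

    whomog₁₃ : ∀ {V} → Homogeneous V (suc (suc (suc zero))) → Whomog col V
    whomog₁₃ {V} hom = I₁₃ , (suc zero , λ { (there ()) }) , same
      where
        same : IWhomog col I₁₃ V
        same x₁ x₂ x₃ y₁ y₂ y₃ x₁∈ x₂∈ x₃∈ x₁<x₂ x₂<x₃ _ y₂∈ _ y₁<y₂ y₂<y₃ agree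
          with agree zero here | agree (suc (suc zero)) (there (there here))
        ... | refl | refl with <-cmp (toℕ x₂) (toℕ y₂)
        ...   | tri< x₂<y₂ _ _ = class-of hom x₁∈ x₂∈ y₂∈ x₃∈ x₁<x₂ x₂<y₂ y₂<y₃
        ...   | tri≈ _ x₂≡y₂ _ = cong (λ y → col x₁ y x₃) (toℕ-injective x₂≡y₂)
        ...   | tri> _ _ y₂<x₂ = sym (class-of hom x₁∈ y₂∈ x₂∈ x₃∈ y₁<y₂ y₂<x₂ x₂<x₃)

    whomog₂₃ : ∀ {V} → Homogeneous V (suc (suc (suc (suc (suc zero))))) → Whomog col V
    whomog₂₃ {V} hom = I₂₃ , (zero , λ ()) , same
      where
        same : IWhomog col I₂₃ V
        same x₁ x₂ x₃ y₁ y₂ y₃ x₁∈ x₂∈ x₃∈ x₁<x₂ x₂<x₃ y₁∈ _ _ y₁<y₂ _ agree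
          with agree (suc zero) (there here) | agree (suc (suc zero)) (there (there here))
        ... | refl | refl with <-cmp (toℕ x₁) (toℕ y₁)
        ...   | tri< x₁<y₁ _ _ = class-of hom x₁∈ y₁∈ x₂∈ x₃∈ x₁<y₁ y₁<y₂ x₂<x₃
        ...   | tri≈ _ x₁≡y₁ _ = cong (λ y → col y x₂ x₃) (toℕ-injective x₁≡y₁)
        ...   | tri> _ _ y₁<x₁ = sym (class-of hom y₁∈ x₁∈ x₂∈ x₃∈ y₁<x₁ x₁<x₂ x₂<x₃)

    NoFive : Subset n → Set
    NoFive V = ∀ {p₁ p₂ p₃ p₄ p₅} → p₁ S.∈ V → p₂ S.∈ V → p₃ S.∈ V → p₄ S.∈ V → p₅ S.∈ V →
      p₁ <ꟳ p₂ → p₂ <ꟳ p₃ → p₃ <ꟳ p₄ → p₄ <ꟳ p₅ → ⊥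

    -- Classes 1, 2 and 4 cannot occur on five points: two of their equalities force a third
    -- colour equality that the class forbids.
    no-five₁ : ∀ {V} → Homogeneous V (suc zero) → NoFive V
    no-five₁ hom p₁∈ p₂∈ p₃∈ p₄∈ p₅∈ p₁<p₂ p₂<p₃ p₃<p₄ p₄<p₅ =
      proj₂ (class-of hom p₁∈ p₃∈ p₄∈ p₅∈ (<-trans p₁<p₂ p₂<p₃) p₃<p₄ p₄<p₅)
        (trans (sym (proj₁ (class-of hom p₁∈ p₂∈ p₃∈ p₄∈ p₁<p₂ p₂<p₃ p₃<p₄)))
               (proj₁ (class-of hom p₁∈ p₂∈ p₃∈ p₅∈ p₁<p₂ p₂<p₃ (<-trans p₃<p₄ p₄<p₅))))

    no-five₂ : ∀ {V} → Homogeneous V (suc (suc zero)) → NoFive V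
    no-five₂ hom p₁∈ p₂∈ p₃∈ p₄∈ p₅∈ p₁<p₂ p₂<p₃ p₃<p₄ p₄<p₅ =
      proj₂ (class-of hom p₂∈ p₃∈ p₄∈ p₅∈ p₂<p₃ p₃<p₄ p₄<p₅)
        (trans (sym (proj₁ (class-of hom p₁∈ p₂∈ p₃∈ p₅∈ p₁<p₂ p₂<p₃ (<-trans p₃<p₄ p₄<p₅))))
               (proj₁ (class-of hom p₁∈ p₂∈ p₄∈ p₅∈ p₁<p₂ (<-trans p₂<p₃ p₃<p₄) p₄<p₅)))

    no-five₄ : ∀ {V} → Homogeneous V (suc (suc (suc (suc zero)))) → NoFive V
    no-five₄ hom p₁∈ p₂∈ p₃∈ p₄∈ p₅∈ p₁<p₂ p₂<p₃ p₃<p₄ p₄<p₅ =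
      proj₂ (class-of hom p₂∈ p₃∈ p₄∈ p₅∈ p₂<p₃ p₃<p₄ p₄<p₅)
        (trans (sym (proj₁ (class-of hom p₁∈ p₂∈ p₃∈ p₄∈ p₁<p₂ p₂<p₃ p₃<p₄)))
               (proj₁ (class-of hom p₁∈ p₂∈ p₃∈ p₅∈ p₁<p₂ p₂<p₃ (<-trans p₃<p₄ p₄<p₅))))

  ∈-pair : {A : Set} {x a b : A} → x ∈ a ∷ b ∷ [] → x ≡ a ⊎ x ≡ b
  ∈-pair (here e) = inj₁ e
  ∈-pair (there (here e)) = inj₂ e

  no-three-in-two : ∀ {n} (xs : List (Fin n)) → length xs ≤ 2 → ∀ {x₁ x₂ x₃} → x₁ ∈ xs → x₂ ∈ xs → x₃ ∈ xs →
    x₁ <ꟳ x₂ → x₂ <ꟳ x₃ → ⊥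
  no-three-in-two (a ∷ []) _ (here refl) (here refl) _ x₁<x₂ _ = <ꟳ⇒≢ x₁<x₂ refl
  no-three-in-two (a ∷ b ∷ []) _ x₁∈ x₂∈ x₃∈ x₁<x₂ x₂<x₃ with ∈-pair x₁∈ | ∈-pair x₂∈ | ∈-pair x₃∈
  ... | inj₁ refl | inj₁ refl | _ = <ꟳ⇒≢ x₁<x₂ refl
  ... | inj₂ refl | inj₂ refl | _ = <ꟳ⇒≢ x₁<x₂ refl
  ... | _ | inj₁ refl | inj₁ refl = <ꟳ⇒≢ x₂<x₃ refl
  ... | _ | inj₂ refl | inj₂ refl = <ꟳ⇒≢ x₂<x₃ refl
  ... | inj₁ refl | inj₂ refl | inj₁ refl = <ꟳ⇒≢ (<-trans x₁<x₂ x₂<x₃) refl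
  ... | inj₂ refl | inj₁ refl | inj₂ refl = <ꟳ⇒≢ (<-trans x₁<x₂ x₂<x₃) refl
  no-three-in-two (_ ∷ _ ∷ _ ∷ _) (s≤s (s≤s ())) _ _ _ _ _

  module _ {n : ℕ} (col : Col3 n) where

    five-points : ∀ (V : Subset n) → 5 ≤ ∣ V ∣ → NoFive col V → ⊥
    five-points V big noFive =
      first-five (elements V) (elements-sorted V) (subst (5 ≤_) (sym (elements-length V)) big) (elements-∈ V)
      where
        first-five : ∀ xs → Sorted xs → 5 ≤ length xs → (∀ {x} → x ∈ xs → x S.∈ V) → ⊥
        first-five (_ ∷ _ ∷ _ ∷ _ ∷ _ ∷ _) ((p₁<p₂ ∷ _) ∷ (p₂<p₃ ∷ _) ∷ (p₃<p₄ ∷ _) ∷ (p₄<p₅ ∷ _) ∷ _) _ ∈V =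
          noFive (∈V (here refl)) (∈V (there (here refl))) (∈V (there (there (here refl))))
            (∈V (there (there (there (here refl))))) (∈V (there (there (there (there (here refl))))))
            p₁<p₂ p₂<p₃ p₃<p₄ p₄<p₅
        first-five [] _ () _
        first-five (_ ∷ []) _ (s≤s ()) _
        first-five (_ ∷ _ ∷ []) _ (s≤s (s≤s ())) _
        first-five (_ ∷ _ ∷ _ ∷ []) _ (s≤s (s≤s (s≤s ()))) _
        first-five (_ ∷ _ ∷ _ ∷ _ ∷ []) _ (s≤s (s≤s (s≤s (s≤s ())))) _

    -- Classes 1, 2, 4: with k + 2 points and no five increasing ones, k ≤ 2, and any k points
    -- form a whomog set, for I = ∅, as they contain no 3-set at all.
    few-points-whomog : ∀ k (V : Subset n) → ∣ V ∣ ≡ k + 2 → NoFive col V →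
      Σ (Subset n) (λ W → ∣ W ∣ ≡ k × Whomog col W)
    few-points-whomog k V size noFive with 3 ≤? k
    ... | yes 3≤k = ⊥-elim (five-points V (subst (5 ≤_) (sym size) (+-monoˡ-≤ 2 3≤k)) noFive)
    ... | no 3≰k = fromList chosen , W-size , ∅ , (zero , λ ()) , vacuous
      where
        chosen : List (Fin n)
        chosen = take k (elements V)
        ∅ : Subset 3
        ∅ = outside ∷ outside ∷ outside ∷ []
        chosen-length : length chosen ≡ k
        chosen-length = trans (length-take k (elements V))
          (m≤n⇒m⊓n≡m (subst (k ≤_) (sym (trans (elements-length V) size)) (m≤m+n k 2)))
        W-size : ∣ fromList chosen ∣ ≡ k
        W-size = trans (fromList-size chosen (Unique.take⁺ k (sorted⇒unique (elements-sorted V)))) chosen-length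
        vacuous : IWhomog col ∅ (fromList chosen)
        vacuous _ _ _ _ _ _ x₁∈ x₂∈ x₃∈ x₁<x₂ x₂<x₃ _ _ _ _ _ _ =
          ⊥-elim (no-three-in-two chosen (subst (_≤ 2) (sym chosen-length) (≤-pred (≰⇒> 3≰k)))
            (fromList-∈ chosen x₁∈) (fromList-∈ chosen x₂∈) (fromList-∈ chosen x₃∈) x₁<x₂ x₂<x₃)

    open Rainbow Fin._≟_ (setColour col) (setColour-≅₃ col) using (SharedPairInjective; SetRainbow; module Greedy)

    -- Class 6: in V, two 3-sets sharing two points get different set colours, since both are
    -- 3-subsets of one 4-set, whose four 3-subsets have pairwise different colours.
    module ClassSix {V : Subset n} (hom : Homogeneous col V (suc (suc (suc (suc (suc (suc zero))))))) where

      χ : Fin n → Fin n → Fin n → ℕ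
      χ = setColour col

      compare : ∀ {x y : Fin n} → x ≢ y → x <ꟳ y ⊎ y <ꟳ x
      compare {x} {y} x≢y with <-cmp (toℕ x) (toℕ y)
      ... | tri< x<y _ _ = inj₁ x<y
      ... | tri≈ _ x≡y _ = ⊥-elim (x≢y (toℕ-injective x≡y))
      ... | tri> _ _ y<x = inj₂ y<x

      colour-via : ∀ {a b c p q r} → Distinct₃ (a , b , c) → Increasing (p , q , r) → (a , b , c) ≅₃ (p , q , r) →
        χ a b c ≡ col p q r
      colour-via d inc s≅ = trans (setColour-≅₃ col d (increasing⇒distinct inc) s≅) (setColour-increasing col inc)

      Agree : Fin n → Fin n → Fin n → Fin n → Set
      Agree a b c d = ∀ {p q r p' q' r'} → Increasing (p , q , r) → (a , b , c) ≅₃ (p , q , r) →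
        Increasing (p' , q' , r') → (a , b , d) ≅₃ (p' , q' , r') → col p q r ≡ col p' q' r'

      agree-from : ∀ {a b c d} → Distinct₃ (a , b , c) → Distinct₃ (a , b , d) → χ a b c ≡ χ a b d → Agree a b c d
      agree-from abc abd same inc s≅ inc' s≅' = trans (sym (colour-via abc inc s≅)) (trans same (colour-via abd inc' s≅'))

      -- The six relative orders of a < b and c < d; in each, {a,b,c} and {a,b,d} are two different
      -- 3-subsets of the 4-set, whose colours the class keeps apart.
      interleavings : ∀ {a b c d} → a S.∈ V → b S.∈ V → c S.∈ V → d S.∈ V → a <ꟳ b → c <ꟳ d →
        a ≢ c → a ≢ d → b ≢ c → b ≢ d → Agree a b c d → ⊥
      interleavings a∈ b∈ c∈ d∈ a<b c<d a≢c a≢d b≢c b≢d agree with compare b≢c | compare a≢c | compare a≢d | compare b≢d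
      ... | inj₁ b<c | _ | _ | _ = AllDistinct.A≢B (class-of col hom a∈ b∈ c∈ d∈ a<b b<c c<d)
            (agree (a<b , b<c) ≅₃-refl (a<b , <-trans b<c c<d) ≅₃-refl)
      ... | inj₂ c<b | inj₁ a<c | _ | inj₁ b<d = AllDistinct.A≢C (class-of col hom a∈ c∈ b∈ d∈ a<c c<b b<d)
            (agree (a<c , c<b) swap₂₃ (<-trans a<c c<b , b<d) ≅₃-refl)
      ... | inj₂ c<b | inj₁ a<c | _ | inj₂ d<b = AllDistinct.B≢C (class-of col hom a∈ c∈ d∈ b∈ a<c c<d d<b)
            (agree (a<c , <-trans c<d d<b) swap₂₃ (<-trans a<c c<d , d<b) swap₂₃)
      ... | inj₂ _ | inj₂ c<a | inj₁ a<d | inj₁ b<d = AllDistinct.A≢D (class-of col hom c∈ a∈ b∈ d∈ c<a a<b b<d)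
            (agree (c<a , a<b) (≅₃-sym rotate) (a<b , b<d) ≅₃-refl)
      ... | inj₂ _ | inj₂ c<a | inj₁ a<d | inj₂ d<b = AllDistinct.B≢D (class-of col hom c∈ a∈ d∈ b∈ c<a a<d d<b)
            (agree (c<a , <-trans a<d d<b) (≅₃-sym rotate) (a<d , d<b) swap₂₃)
      ... | inj₂ _ | inj₂ c<a | inj₂ d<a | _ = AllDistinct.C≢D (class-of col hom c∈ d∈ a∈ b∈ c<d d<a a<b)
            (agree (<-trans c<d d<a , a<b) (≅₃-sym rotate) (d<a , a<b) (≅₃-sym rotate))

      apart-from : ∀ {a b c d} → a S.∈ V → b S.∈ V → c S.∈ V → d S.∈ V →
        a <ꟳ b → a ≢ c → a ≢ d → b ≢ c → b ≢ d → c ≢ d → χ a b c ≢ χ a b d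
      apart-from {a} {b} {c} {d} a∈ b∈ c∈ d∈ a<b a≢c a≢d b≢c b≢d c≢d same =
        [ (λ c<d → interleavings a∈ b∈ c∈ d∈ a<b c<d a≢c a≢d b≢c b≢d (agree-from abc abd same))
        , (λ d<c → interleavings a∈ b∈ d∈ c∈ a<b d<c a≢d a≢c b≢d b≢c (agree-from abd abc (sym same)))
        ] (compare c≢d)
        where
          abc : Distinct₃ (a , b , c)
          abc = <ꟳ⇒≢ a<b , a≢c , b≢c
          abd : Distinct₃ (a , b , d)
          abd = <ꟳ⇒≢ a<b , a≢d , b≢d

      apart : ∀ {a b c d} → a S.∈ V → b S.∈ V → c S.∈ V → d S.∈ V →
        a ≢ b → a ≢ c → a ≢ d → b ≢ c → b ≢ d → c ≢ d → χ a b c ≢ χ a b d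
      apart a∈ b∈ c∈ d∈ a≢b a≢c a≢d b≢c b≢d c≢d same with compare a≢b
      ... | inj₁ a<b = apart-from a∈ b∈ c∈ d∈ a<b a≢c a≢d b≢c b≢d c≢d same
      ... | inj₂ b<a = apart-from b∈ a∈ c∈ d∈ b<a b≢c b≢d a≢c a≢d c≢d
            (trans (setColour-≅₃ col (≢-sym a≢b , b≢c , a≢c) (a≢b , a≢c , b≢c) swap₁₂)
              (trans same (setColour-≅₃ col (a≢b , a≢d , b≢d) (≢-sym a≢b , b≢d , a≢d) swap₁₂)))

      shared-pair : SharedPairInjective (elements V)
      shared-pair {c = c} {d} a∈ b∈ c∈ d∈ a≢b a≢c a≢d b≢c b≢d same with c Fin.≟ d
      ... | yes c≡d = c≡d
      ... | no c≢d = ⊥-elim (apart (∈V a∈) (∈V b∈) (∈V c∈) (∈V d∈) a≢b a≢c a≢d b≢c b≢d c≢d same)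
        where
          ∈V : ∀ {x} → x ∈ elements V → x S.∈ V
          ∈V = elements-∈ V

    -- On increasing triples the set colour is the original colour, so a list spanning a
    -- rainbow for set colours gives a rainbow subset.
    rainbow-of-list : ∀ T → SetRainbow T → Rainbow col (fromList T)
    rainbow-of-list T setRainbow x₁ x₂ x₃ y₁ y₂ y₃ x₁∈ x₂∈ x₃∈ x₁<x₂ x₂<x₃ y₁∈ y₂∈ y₃∈ y₁<y₂ y₂<y₃ same =
      components (increasing-unique (x₁<x₂ , x₂<x₃) (y₁<y₂ , y₂<y₃)
        (setRainbow (∈T x₁∈) (∈T x₂∈) (∈T x₃∈) (∈T y₁∈) (∈T y₂∈) (∈T y₃∈)
          (increasing⇒distinct (x₁<x₂ , x₂<x₃)) (increasing⇒distinct (y₁<y₂ , y₂<y₃))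
          (trans (setColour-increasing col (x₁<x₂ , x₂<x₃)) (trans same (sym (setColour-increasing col (y₁<y₂ , y₂<y₃)))))))
      where
        ∈T : ∀ {x} → x S.∈ fromList T → x ∈ T
        ∈T = fromList-∈ T
        components : ∀ {x₁ x₂ x₃ y₁ y₂ y₃ : Fin n} → (x₁ , x₂ , x₃) ≡ (y₁ , y₂ , y₃) → x₁ ≡ y₁ × x₂ ≡ y₂ × x₃ ≡ y₃
        components refl = refl , refl , refl

    rainbow-from-class₆ : ∀ k (V : Subset n) → ∣ V ∣ ≡ k ^ 5 →
      Homogeneous col V (suc (suc (suc (suc (suc (suc zero)))))) → Σ (Subset n) (λ W → ∣ W ∣ ≡ k × Rainbow col W)
    rainbow-from-class₆ k V size hom =
      let (T , unique , _ , len , setRainbow) = Greedy.extract (elements V) (ClassSix.shared-pair hom) k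
            (sorted⇒unique (elements-sorted V)) (≤-reflexive (sym (trans (elements-length V) size)))
      in fromList T , trans (fromList-size T unique) len , rainbow-of-list T setRainbow

open Classes

mainTheorem8 : ∀ (k₁ k₂ : ℕ) → 1 ≤ k₁ → 1 ≤ k₂ →
    ∀ (r : ℕ) →
    IsLeast (R4Prop 7 (k₁ ∷ k₁ + 2 ∷ k₁ + 2 ∷ k₁ ∷ k₁ + 2 ∷ k₁ ∷ k₂ ^ 5 ∷ [])) r →
    WERProp k₁ k₂ r
mainTheorem8 k₁ k₂ _ _ r (ramsey , _) COL with ramsey (classColouring COL)
... | zero , V , size , hom = inj₁ (V , size , whomog₁₂ COL hom)
... | suc zero , V , size , hom = inj₁ (few-points-whomog COL k₁ V size (no-five₁ COL hom))
... | suc (suc zero) , V , size , hom = inj₁ (few-points-whomog COL k₁ V size (no-five₂ COL hom))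
... | suc (suc (suc zero)) , V , size , hom = inj₁ (V , size , whomog₁₃ COL hom)
... | suc (suc (suc (suc zero))) , V , size , hom = inj₁ (few-points-whomog COL k₁ V size (no-five₄ COL hom))
... | suc (suc (suc (suc (suc zero)))) , V , size , hom = inj₁ (V , size , whomog₂₃ COL hom)
... | suc (suc (suc (suc (suc (suc zero))))) , V , size , hom = inj₂ (rainbow-from-class₆ COL k₂ V size hom)
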